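{- There exists a triangle-free graph which is not Kempe connected.
   Context: All graphs are finite and simple. A $k$-colouring of $G$ is a proper colouring $V(G)\to\{1,\dots,k\}$; $\mathcal{C}_k(G)$ is the set of all $k$-colourings and $\chi(G)$ the chromatic number. A Kempe chain (for a colouring and two colours $a,b$) is a connected component of the subgraph induced by the vertices coloured $a$ or $b$; a Kempe swap interchanges $a$ and $b$ on one Kempe chain. Two colourings are Kempe equivalent if each can be obtained from the other by a sequence of Kempe swaps; a set of colourings forms a Kempe class if its members are pairwise Kempe equivalent. $G$ is Kempe connected if $\mathcal{C}_k(G)$ forms a Kempe class for every $k\ge\chi(G)$. A graph is triangle-free if it has no three pairwise adjacent vertices. -}

module Defs where

open import Data.Nat using (ℕ; _≤_; _<_)
open import Data.Fin using (Fin)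
open import Data.Bool using (Bool; true; false)
open import Data.Product using (Σ; ∃; ∃-syntax; _×_; _,_)
open import Data.Sum using (_⊎_)
open import Data.Empty using (⊥)
open import Relation.Nullary using (¬_; Dec; yes; no)
open import Relation.Binary.PropositionalEquality using (_≡_; _≢_)
open import Relation.Binary.Construct.Closure.ReflexiveTransitive using (Star)
import Data.Fin as F

record Graph : Set where
  field
    n      : ℕ
    adj    : Fin n → Fin n → Bool
    sym    : ∀ u v → adj u v ≡ true → adj v u ≡ true
    irrefl : ∀ v → adj v v ≡ false

open Graph public

TriangleFree : Graph → Set
TriangleFree G = ∀ x y z → adj G x y ≡ true → adj G y z ≡ true → adj G x z ≡ true → ⊥

Assignment : Graph → ℕ → Set
Assignment G k = Fin (n G) → Fin k

Proper : (G : Graph) {k : ℕ} → Assignment G k → Set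
Proper G c = ∀ u v → adj G u v ≡ true → c u ≢ c v

Colouring : Graph → ℕ → Set
Colouring G k = Σ (Assignment G k) (Proper G)

Colourable : Graph → ℕ → Set
Colourable G k = Colouring G k

IsChromaticNumber : Graph → ℕ → Set
IsChromaticNumber G m = Colourable G m × (∀ j → j < m → ¬ Colourable G j)

InAB : {k : ℕ} → Fin k → Fin k → Fin k → Set
InAB a b x = (x ≡ a) ⊎ (x ≡ b)

-- SameChain G c a b v u : u lies in the Kempe chain (for colours a,b) of v,
-- i.e. u is reachable from v in the subgraph induced by vertices coloured a or b.
data SameChain (G : Graph) {k : ℕ} (c : Assignment G k) (a b : Fin k)
       (v : Fin (n G)) : Fin (n G) → Set where
  here : InAB a b (c v) → SameChain G c a b v v
  step : ∀ {u w} → SameChain G c a b v u → adj G u w ≡ true →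
         InAB a b (c w) → SameChain G c a b v w

swapAB : {k : ℕ} → Fin k → Fin k → Fin k → Fin k
swapAB a b x with x F.≟ a
... | yes _ = b
... | no _ with x F.≟ b
...   | yes _ = a
...   | no _ = x

KempeSwap : (G : Graph) {k : ℕ} → Assignment G k → Assignment G k → Set
KempeSwap G {k} c c' =
  ∃[ a ] ∃[ b ] ∃[ v ] (InAB a b (c v) ×
    (∀ u → (SameChain G c a b v u → c' u ≡ swapAB a b (c u)) ×
           (¬ SameChain G c a b v u → c' u ≡ c u)))

KempeEquivalent : (G : Graph) {k : ℕ} → Colouring G k → Colouring G k → Set
KempeEquivalent G (c₁ , _) (c₂ , _) = Star (KempeSwap G) c₁ c₂

KempeConnected : Graph → Set
KempeConnected G = ∀ m k → IsChromaticNumber G m → m ≤ k →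
  (c₁ c₂ : Colouring G k) → KempeEquivalent G c₁ c₂

-- In the 3-colouring c₀ of the triangle-free circulant C₁₂(2, 3) that colours
-- u by ⌊u/2⌋ mod 3, any two colour classes induce a connected subgraph.  Hence
-- every Kempe swap of c₀ exchanges two whole colour classes, i.e. merely permutes
-- colours, and this property is inherited by the result.  So the Kempe class of
-- c₀ consists of colour permutations of c₀, which all give 0 and 1 the same
-- colour; the rotated 3-colouring u ↦ ⌊(u+1)/2⌋ mod 3 does not.  As χ(C₁₂(2, 3))
-- = 3 (it contains a 5-cycle), C₁₂(2, 3) is not Kempe connected.

module Submission where

open import Defs
open import Data.Bool using (Bool; true; false; T; _∨_)
import Data.Bool as Bool
open import Data.Bool.Properties using (T-≡; ∨-comm)
open import Data.Empty using (⊥-elim)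
open import Data.Fin using (Fin; suc; toℕ; _≟_)
open import Data.Fin.Patterns
open import Data.Fin.Permutation using (Permutation′; _⟨$⟩ʳ_; _⟨$⟩ˡ_; inverseˡ; inverseʳ; transpose; _∘ₚ_)
import Data.Fin.Permutation as Perm
open import Data.Fin.Properties using (all?)
open import Data.Nat using (ℕ; suc; _∸_; _<_; s≤s)
open import Data.Nat.Properties using (n∸n≡0; ≤-refl)
open import Data.Product using (Σ; ∃; ∃₂; _×_; _,_; proj₁; proj₂)
open import Data.Sum using (inj₁; inj₂)
open import Data.Vec using ([]; _∷_; lookup)
open import Function using (_∘_; Equivalence)
open import Relation.Binary.Construct.Closure.ReflexiveTransitive using (Star; ε; _◅_)
open import Relation.Binary.PropositionalEquality
  using (_≡_; _≢_; refl; trans; cong)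
import Relation.Binary.PropositionalEquality as ≡
open import Relation.Nullary using (¬_; Dec; yes; no)
open import Relation.Nullary.Decidable
  using (True; toWitness; from-yes; decidable-stable; _⊎-dec_; _→-dec_; ¬?)

pattern 10F = suc 9F
pattern 11F = suc 10F

inAB? : ∀ {k} (a b x : Fin k) → Dec (InAB a b x)
inAB? a b x = (x ≟ a) ⊎-dec (x ≟ b)

InAB-comm : ∀ {k} {a b x : Fin k} → InAB a b x → InAB b a x
InAB-comm (inj₁ x≡a) = inj₂ x≡a
InAB-comm (inj₂ x≡b) = inj₁ x≡b

InAB-map : ∀ {k l} (f : Fin k → Fin l) {a b x} → InAB a b x → InAB (f a) (f b) (f x)
InAB-map f (inj₁ x≡a) = inj₁ (cong f x≡a)
InAB-map f (inj₂ x≡b) = inj₂ (cong f x≡b)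

InAB-resp : ∀ {k} {a a′ b b′ x x′ : Fin k} →
  a ≡ a′ → b ≡ b′ → x ≡ x′ → InAB a b x → InAB a′ b′ x′
InAB-resp refl refl refl h = h

swapAB≡transpose : ∀ {k} (a b x : Fin k) → swapAB a b x ≡ transpose a b ⟨$⟩ʳ x
swapAB≡transpose a b x with x ≟ a
... | yes _ = refl
... | no _ with x ≟ b
...   | yes _ = refl
...   | no _ = refl

swapAB-self : ∀ {k} (a x : Fin k) → x ≡ swapAB a a x
swapAB-self a x with x ≟ a
... | yes x≡a = x≡a
... | no _ with x ≟ a
...   | yes x≡a = x≡a
...   | no _ = refl

swapAB-outside : ∀ {k} {a b x : Fin k} → ¬ InAB a b x → x ≡ swapAB a b x
swapAB-outside {a = a} {b} {x} x∉ab with x ≟ a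
... | yes x≡a = ⊥-elim (x∉ab (inj₁ x≡a))
... | no _ with x ≟ b
...   | yes x≡b = ⊥-elim (x∉ab (inj₂ x≡b))
...   | no _ = refl

module _ (G : Graph) {k : ℕ} where

  SameChain-map : ∀ {c d : Assignment G k} {a b a′ b′ v u} →
    (∀ w → InAB a b (c w) → InAB a′ b′ (d w)) →
    SameChain G c a b v u → SameChain G d a′ b′ v u
  SameChain-map {v = v} f (here cv) = here (f v cv)
  SameChain-map f (step {w = w} p e cw) = step (SameChain-map f p) e (f w cw)

  SameChain-comm : ∀ {c : Assignment G k} {a b v u} →
    SameChain G c a b v u → SameChain G c b a v u
  SameChain-comm = SameChain-map (λ _ → InAB-comm)

  module _ {c : Assignment G k} {a b : Fin k} where

    SameChain-InAB : ∀ {v u} → SameChain G c a b v u → InAB a b (c u)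
    SameChain-InAB (here cv) = cv
    SameChain-InAB (step _ _ cw) = cw

    SameChain-trans : ∀ {v u w} →
      SameChain G c a b v u → SameChain G c a b u w → SameChain G c a b v w
    SameChain-trans p (here _) = p
    SameChain-trans p (step q e cw) = step (SameChain-trans p q) e cw

    SameChain-sym : ∀ {v u} → SameChain G c a b v u → SameChain G c a b u v
    SameChain-sym (here cv) = here cv
    SameChain-sym (step {u} {w} p e cw) =
      SameChain-trans (step (here cw) (sym G u w e) (SameChain-InAB p)) (SameChain-sym p)

    SameChain-root : (r : Fin (n G)) → (∀ u → InAB a b (c u) → SameChain G c a b r u) →
      ∀ v u → InAB a b (c v) → InAB a b (c u) → SameChain G c a b v u
    SameChain-root r reach v u cv cu = SameChain-trans (SameChain-sym (reach v cv)) (reach u cu)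

  BichromaticConnected : Assignment G k → Set
  BichromaticConnected c = ∀ {a b} → a ≢ b →
    ∀ v u → InAB a b (c v) → InAB a b (c u) → SameChain G c a b v u

  Relabelling : Assignment G k → Assignment G k → Set
  Relabelling c₀ c = ∃ λ (π : Permutation′ k) → ∀ u → c u ≡ π ⟨$⟩ʳ c₀ u

  BichromaticConnected-relabelling : ∀ {c₀ c} →
    BichromaticConnected c₀ → Relabelling c₀ c → BichromaticConnected c
  BichromaticConnected-relabelling {c₀} {c} conn (π , c≡πc₀) {a} {b} a≢b v u cv cu =
    SameChain-map toC (conn a′≢b′ v u (toC₀ v cv) (toC₀ u cu))
    where
    a′ b′ : Fin k
    a′ = π ⟨$⟩ˡ a
    b′ = π ⟨$⟩ˡ b
    a′≢b′ : a′ ≢ b′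
    a′≢b′ eq = a≢b (trans (≡.sym (inverseʳ π)) (trans (cong (π ⟨$⟩ʳ_) eq) (inverseʳ π)))
    toC₀ : ∀ w → InAB a b (c w) → InAB a′ b′ (c₀ w)
    toC₀ w = InAB-resp refl refl (inverseˡ π) ∘ InAB-map (π ⟨$⟩ˡ_) ∘ InAB-resp refl refl (c≡πc₀ w)
    toC : ∀ w → InAB a′ b′ (c₀ w) → InAB a b (c w)
    toC w = InAB-resp (inverseʳ π) (inverseʳ π) (≡.sym (c≡πc₀ w)) ∘ InAB-map (π ⟨$⟩ʳ_)

  module _ {c c′ : Assignment G k} {a b : Fin k} {v : Fin (n G)}
           (swap : ∀ u → (SameChain G c a b v u → c′ u ≡ swapAB a b (c u)) ×
                         (¬ SameChain G c a b v u → c′ u ≡ c u)) where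

    -- Chain membership need not be decided: the goal is decidable, and if it
    -- failed, u would lie off the chain, where c′ u ≡ c u.
    kempeSwap-fixed : ∀ u → c u ≡ swapAB a b (c u) → c′ u ≡ swapAB a b (c u)
    kempeSwap-fixed u fixed = decidable-stable (c′ u ≟ swapAB a b (c u)) λ c′u≢ →
      c′u≢ (trans (proj₂ (swap u) (c′u≢ ∘ proj₁ (swap u))) fixed)

  kempeSwap-swapAB : ∀ {c c′} → BichromaticConnected c → KempeSwap G c c′ →
    ∃₂ λ a b → ∀ u → c′ u ≡ swapAB a b (c u)
  kempeSwap-swapAB {c} {c′} conn (a , b , v , cv , swap) = a , b , swapped
    where
    swapped : ∀ u → c′ u ≡ swapAB a b (c u)
    swapped u with a ≟ b | inAB? a b (c u)
    ... | yes refl | _      = kempeSwap-fixed swap u (swapAB-self a (c u))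
    ... | no _     | no cu  = kempeSwap-fixed swap u (swapAB-outside cu)
    ... | no a≢b   | yes cu = proj₁ (swap u) (conn a≢b v u cv cu)

  kempeEquivalent-relabelling : ∀ {c₀ c c′} → BichromaticConnected c₀ →
    Relabelling c₀ c → Star (KempeSwap G) c c′ → Relabelling c₀ c′
  kempeEquivalent-relabelling conn rel ε = rel
  kempeEquivalent-relabelling {c₀} {c} conn rel@(π , c≡πc₀) (_◅_ {j = c″} s ss)
    with kempeSwap-swapAB (BichromaticConnected-relabelling conn rel) s
  ... | a , b , swapped = kempeEquivalent-relabelling conn (π ∘ₚ transpose a b , relabelled) ss
    where
    relabelled : ∀ u → c″ u ≡ (π ∘ₚ transpose a b) ⟨$⟩ʳ c₀ u
    relabelled u = trans (swapped u)
      (trans (swapAB≡transpose a b (c u)) (cong (transpose a b ⟨$⟩ʳ_) (c≡πc₀ u)))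

module _ {G : Graph} {k : ℕ} {c : Assignment G k} {a b : Fin k} where

  start : (v : Fin (n G)) → {True (inAB? a b (c v))} → SameChain G c a b v v
  start v {cv} = here (toWitness cv)

  infixl 5 _▸_
  _▸_ : ∀ {v u} → SameChain G c a b v u → (w : Fin (n G)) →
    {T (adj G u w)} → {True (inAB? a b (c w))} → SameChain G c a b v w
  (p ▸ w) {e} {cw} = step p (Equivalence.to T-≡ e) (toWitness cw)

triangleFree? : (G : Graph) → Dec (TriangleFree G)
triangleFree? G = all? λ x → all? λ y → all? λ z →
  (adj G x y Bool.≟ true) →-dec (adj G y z Bool.≟ true) →-dec (adj G x z Bool.≟ true) →-dec no (λ ())

proper? : (G : Graph) {k : ℕ} (c : Assignment G k) → Dec (Proper G c)
proper? G c = all? λ u → all? λ v → (adj G u v Bool.≟ true) →-dec ¬? (c u ≟ c v)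

fin2-≢-≢⇒≡ : {x y z : Fin 2} → x ≢ y → y ≢ z → x ≡ z
fin2-≢-≢⇒≡ {0F} {0F} x≢y _ = ⊥-elim (x≢y refl)
fin2-≢-≢⇒≡ {1F} {1F} x≢y _ = ⊥-elim (x≢y refl)
fin2-≢-≢⇒≡ {_} {0F} {0F} _ y≢z = ⊥-elim (y≢z refl)
fin2-≢-≢⇒≡ {_} {1F} {1F} _ y≢z = ⊥-elim (y≢z refl)
fin2-≢-≢⇒≡ {0F} {1F} {0F} _ _ = refl
fin2-≢-≢⇒≡ {1F} {0F} {1F} _ _ = refl

-- The circulant graph C₁₂(2, 3): u ∼ v iff u − v ≡ ±2 or ±3 (mod 12).
isChordLength : ℕ → Bool
isChordLength 2 = true
isChordLength 3 = true
isChordLength 9 = true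
isChordLength 10 = true
isChordLength _ = false

C₁₂ : Graph
C₁₂ = record
  { n = 12
  ; adj = adjacent
  ; sym = λ u v → trans (∨-comm (isChordLength (toℕ v ∸ toℕ u)) (isChordLength (toℕ u ∸ toℕ v)))
  ; irrefl = λ v → cong (λ d → isChordLength d ∨ isChordLength d) (n∸n≡0 (toℕ v))
  }
  where
  adjacent : Fin 12 → Fin 12 → Bool
  adjacent u v = isChordLength (toℕ u ∸ toℕ v) ∨ isChordLength (toℕ v ∸ toℕ u)

C₁₂-triangleFree : TriangleFree C₁₂
C₁₂-triangleFree = from-yes (triangleFree? C₁₂)

c₀ c₁ : Assignment C₁₂ 3
c₀ = lookup (0F ∷ 0F ∷ 1F ∷ 1F ∷ 2F ∷ 2F ∷ 0F ∷ 0F ∷ 1F ∷ 1F ∷ 2F ∷ 2F ∷ [])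
c₁ = lookup (0F ∷ 1F ∷ 1F ∷ 2F ∷ 2F ∷ 0F ∷ 0F ∷ 1F ∷ 1F ∷ 2F ∷ 2F ∷ 0F ∷ [])

col₀ col₁ : Colouring C₁₂ 3
col₀ = c₀ , from-yes (proper? C₁₂ c₀)
col₁ = c₁ , from-yes (proper? C₁₂ c₁)

χ[C₁₂]≡3 : IsChromaticNumber C₁₂ 3
χ[C₁₂]≡3 = col₀ , noColouring
  where
  noColouring : ∀ j → j < 3 → ¬ Colourable C₁₂ j
  noColouring 0 _ (c , _) with c 0F
  ... | ()
  noColouring 1 _ (c , proper) with c 0F | c 2F | proper 0F 2F refl
  ... | 0F | 0F | c₀≢c₂ = c₀≢c₂ refl
  -- 0, 2, 4, 6, 9 is a 5-cycle.
  noColouring 2 _ (c , proper) = proper 9F 0F refl (≡.sym (trans c₀≡c₄ c₄≡c₉))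
    where
    c₀≡c₄ : c 0F ≡ c 4F
    c₀≡c₄ = fin2-≢-≢⇒≡ (proper 0F 2F refl) (proper 2F 4F refl)
    c₄≡c₉ : c 4F ≡ c 9F
    c₄≡c₉ = fin2-≢-≢⇒≡ (proper 4F 6F refl) (proper 6F 9F refl)
  noColouring (suc (suc (suc _))) (s≤s (s≤s (s≤s ())))

c₀-bichromaticConnected : BichromaticConnected C₁₂ c₀
c₀-bichromaticConnected {0F} {1F} _ = SameChain-root C₁₂ 0F reach₀₁
  where
  reach₀₁ : ∀ u → InAB 0F 1F (c₀ u) → SameChain C₁₂ c₀ 0F 1F 0F u
  reach₀₁ 0F  _ = start 0F
  reach₀₁ 1F  _ = start 0F ▸ 3F ▸ 1F
  reach₀₁ 2F  _ = start 0F ▸ 2F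
  reach₀₁ 3F  _ = start 0F ▸ 3F
  reach₀₁ 4F  = λ { (inj₁ ()) ; (inj₂ ()) }
  reach₀₁ 5F  = λ { (inj₁ ()) ; (inj₂ ()) }
  reach₀₁ 6F  _ = start 0F ▸ 3F ▸ 6F
  reach₀₁ 7F  _ = start 0F ▸ 9F ▸ 7F
  reach₀₁ 8F  _ = start 0F ▸ 3F ▸ 6F ▸ 8F
  reach₀₁ 9F  _ = start 0F ▸ 9F
  reach₀₁ 10F = λ { (inj₁ ()) ; (inj₂ ()) }
  reach₀₁ 11F = λ { (inj₁ ()) ; (inj₂ ()) }
c₀-bichromaticConnected {0F} {2F} _ = SameChain-root C₁₂ 0F reach₀₂
  where
  reach₀₂ : ∀ u → InAB 0F 2F (c₀ u) → SameChain C₁₂ c₀ 0F 2F 0F u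
  reach₀₂ 0F  _ = start 0F
  reach₀₂ 1F  _ = start 0F ▸ 10F ▸ 1F
  reach₀₂ 2F  = λ { (inj₁ ()) ; (inj₂ ()) }
  reach₀₂ 3F  = λ { (inj₁ ()) ; (inj₂ ()) }
  reach₀₂ 4F  _ = start 0F ▸ 10F ▸ 1F ▸ 4F
  reach₀₂ 5F  _ = start 0F ▸ 10F ▸ 7F ▸ 5F
  reach₀₂ 6F  _ = start 0F ▸ 10F ▸ 1F ▸ 4F ▸ 6F
  reach₀₂ 7F  _ = start 0F ▸ 10F ▸ 7F
  reach₀₂ 8F  = λ { (inj₁ ()) ; (inj₂ ()) }
  reach₀₂ 9F  = λ { (inj₁ ()) ; (inj₂ ()) }
  reach₀₂ 10F _ = start 0F ▸ 10F
  reach₀₂ 11F _ = start 0F ▸ 10F ▸ 1F ▸ 11F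
c₀-bichromaticConnected {1F} {2F} _ = SameChain-root C₁₂ 2F reach₁₂
  where
  reach₁₂ : ∀ u → InAB 1F 2F (c₀ u) → SameChain C₁₂ c₀ 1F 2F 2F u
  reach₁₂ 0F  = λ { (inj₁ ()) ; (inj₂ ()) }
  reach₁₂ 1F  = λ { (inj₁ ()) ; (inj₂ ()) }
  reach₁₂ 2F  _ = start 2F
  reach₁₂ 3F  _ = start 2F ▸ 5F ▸ 3F
  reach₁₂ 4F  _ = start 2F ▸ 4F
  reach₁₂ 5F  _ = start 2F ▸ 5F
  reach₁₂ 6F  = λ { (inj₁ ()) ; (inj₂ ()) }
  reach₁₂ 7F  = λ { (inj₁ ()) ; (inj₂ ()) }
  reach₁₂ 8F  _ = start 2F ▸ 5F ▸ 8F
  reach₁₂ 9F  _ = start 2F ▸ 11F ▸ 9F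
  reach₁₂ 10F _ = start 2F ▸ 5F ▸ 8F ▸ 10F
  reach₁₂ 11F _ = start 2F ▸ 11F
c₀-bichromaticConnected {1F} {0F} _ v u cv cu =
  SameChain-comm C₁₂ (c₀-bichromaticConnected {0F} {1F} (λ ()) v u (InAB-comm cv) (InAB-comm cu))
c₀-bichromaticConnected {2F} {0F} _ v u cv cu =
  SameChain-comm C₁₂ (c₀-bichromaticConnected {0F} {2F} (λ ()) v u (InAB-comm cv) (InAB-comm cu))
c₀-bichromaticConnected {2F} {1F} _ v u cv cu =
  SameChain-comm C₁₂ (c₀-bichromaticConnected {1F} {2F} (λ ()) v u (InAB-comm cv) (InAB-comm cu))
c₀-bichromaticConnected {0F} {0F} a≢a = ⊥-elim (a≢a refl)
c₀-bichromaticConnected {1F} {1F} a≢a = ⊥-elim (a≢a refl)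
c₀-bichromaticConnected {2F} {2F} a≢a = ⊥-elim (a≢a refl)

c₁-not-relabelling : ¬ Relabelling C₁₂ c₀ c₁
c₁-not-relabelling (π , c₁≡πc₀) with trans (c₁≡πc₀ 0F) (≡.sym (c₁≡πc₀ 1F))
... | ()

C₁₂-notKempeConnected : ¬ KempeConnected C₁₂
C₁₂-notKempeConnected kempeConnected =
  c₁-not-relabelling (kempeEquivalent-relabelling C₁₂ c₀-bichromaticConnected
    (Perm.id , λ _ → refl) (kempeConnected 3 3 χ[C₁₂]≡3 ≤-refl col₀ col₁))

lemma2 : Σ Graph (λ G → TriangleFree G × ¬ KempeConnected G)
lemma2 = C₁₂ , C₁₂-triangleFree , C₁₂-notKempeConnected
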